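{- For any nonnegative integer $a$ and positive integer $p$, $$\sum_{q=0}^{a}\binom{a}{q}\frac{(-1)^{q+1-p}\,c(q+1,p)}{(q+1)!}=\frac{c(a+1,p)}{(a+1)!},$$ where $c(\cdot,\cdot)$ are the signless Stirling numbers of the first kind.
   Context: $c(n,p)$ is the number of permutations of $[n]$ with exactly $p$ cycles, equivalently $c(n,p)=[x^p]\,x(x+1)\cdots(x+n-1)$. -}

module Defs where

open import Data.Nat as ℕ using (ℕ; zero; suc; _!)
open import Data.Nat.Properties using (_!≢0)
open import Data.Nat.Combinatorics using (_C_)
open import Data.Integer as ℤ using (ℤ; +_)
open import Data.Rational as ℚ using (ℚ; _/_; _+_; _*_; 0ℚ; 1ℚ; -_)
open import Data.List using (List; []; _∷_; lookup; length)
open import Data.Maybe using (Maybe; just; nothing)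

-- Polynomials over ℕ as coefficient lists (constant term first).
Poly : Set
Poly = List ℕ

coeff : Poly → ℕ → ℕ
coeff []       _       = 0
coeff (a ∷ as) zero    = a
coeff (a ∷ as) (suc p) = coeff as p

shiftX : Poly → Poly
shiftX f = 0 ∷ f

scale : ℕ → Poly → Poly
scale k []       = []
scale k (a ∷ as) = k ℕ.* a ∷ scale k as

addP : Poly → Poly → Poly
addP []       g        = g
addP f        []       = f
addP (a ∷ as) (b ∷ bs) = a ℕ.+ b ∷ addP as bs

mulLinear : ℕ → Poly → Poly
mulLinear k f = addP (shiftX f) (scale k f)

rising : ℕ → Poly
rising zero    = 1 ∷ []
rising (suc n) = mulLinear n (rising n)

-- signless Stirling numbers of the first kind: c(n,p) = [x^p] x(x+1)⋯(x+n-1)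
c : ℕ → ℕ → ℕ
c n p = coeff (rising n) p

sgn : ℕ → ℚ
sgn zero    = 1ℚ
sgn (suc k) = - sgn k

-- (-1)^(m - p) for natural m, p (integer exponent m - p, possibly negative);
-- depends only on parity, so equals (-1)^(m + p).
sgnDiff : ℕ → ℕ → ℚ
sgnDiff m p = sgn (m ℕ.+ p)

sumTo : ℕ → (ℕ → ℚ) → ℚ
sumTo zero    f = f 0
sumTo (suc a) f = sumTo a f + f (suc a)

_/!_ : ℕ → ℕ → ℚ
n /! m = ((+ n) / (m !)) {{m !≢0}}

term : ℕ → ℕ → ℕ → ℚ
term a p q = ((+ (a C q)) / 1) * (sgnDiff (suc q) p * (c (suc q) p /! suc q))

-- Writing (x)ₙ = x(x − 1)⋯(x − n + 1) for the falling factorial, Vandermonde's identity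
-- Σ_q C(a,q) C(x,q+k) = C(x+a,a+k) becomes, as an identity between polynomials in x,
--   Σ_q C(a,q) (x)_{k+q} / (k+q)!  =  (x + 1)(x + 2)⋯(x + a) · (x)_k / (k+a)!,
-- which follows by induction on a from Pascal's rule (for arbitrary k: the case k = 1
-- alone is not inductive). For k = 1 the right-hand numerator is x(x + 1)⋯(x + a), whose
-- coefficients are c(a+1,p), while (x)ₙ has coefficients (−1)^(n−p) c(n,p); comparing
-- coefficients of x^p gives the theorem.
module Submission where

open import Defs
open import Data.Nat as ℕ using (ℕ; zero; suc; _!; _≥_)
open import Data.Nat.Properties using (_!≢0; m*n≢0; +-suc; +-identityʳ; *-zeroʳ; n<1+n)
open import Data.Nat.Combinatorics using (_C_; nCn≡1; nCk≡nC[n∸k]; nCk+nC[k+1]≡[n+1]C[k+1])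
open import Data.Nat.Combinatorics.Specification using (k>n⇒nCk≡0)
open import Data.Integer as ℤ using (+_)
import Data.Integer.Properties as ℤ
import Data.Integer.Solver
open import Data.Rational using (ℚ; _/_; _+_; _*_; -_; 0ℚ; 1ℚ; fromℚᵘ; toℚᵘ)
open import Data.Rational.Properties
  using (toℚᵘ-injective; toℚᵘ-fromℚᵘ; toℚᵘ-homo-+; toℚᵘ-homo-*; fromℚᵘ-cong)
import Data.Rational.Properties as ℚ
import Data.Rational.Solver
open import Data.Rational.Unnormalised as ℚᵘ using (ℚᵘ; mkℚᵘ; *≡*)
import Data.Rational.Unnormalised.Properties as ℚᵘ
open import Data.List using ([]; _∷_)
open import Function using (_∘_)
open import Relation.Binary.PropositionalEquality
  using (_≡_; _≗_; refl; sym; trans; cong; cong₂; module ≡-Reasoning)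

module ℤ-Solver = Data.Integer.Solver.+-*-Solver
module ℚ-Solver = Data.Rational.Solver.+-*-Solver

fromℚᵘ-homo₂ : ∀ {_∙_ : ℚ → ℚ → ℚ} {_∙ᵘ_ : ℚᵘ → ℚᵘ → ℚᵘ} →
  (∀ x y → toℚᵘ (x ∙ y) ℚᵘ.≃ toℚᵘ x ∙ᵘ toℚᵘ y) →
  (∀ {x x′ y y′} → x ℚᵘ.≃ x′ → y ℚᵘ.≃ y′ → x ∙ᵘ y ℚᵘ.≃ x′ ∙ᵘ y′) →
  ∀ x y → fromℚᵘ (x ∙ᵘ y) ≡ fromℚᵘ x ∙ fromℚᵘ y
fromℚᵘ-homo₂ {_∙_} {_∙ᵘ_} toℚᵘ-homo ∙ᵘ-cong x y = toℚᵘ-injective (begin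
  toℚᵘ (fromℚᵘ (x ∙ᵘ y))                ≈⟨ toℚᵘ-fromℚᵘ (x ∙ᵘ y) ⟩
  x ∙ᵘ y                                 ≈⟨ ∙ᵘ-cong (ℚᵘ.≃-sym (toℚᵘ-fromℚᵘ x)) (ℚᵘ.≃-sym (toℚᵘ-fromℚᵘ y)) ⟩
  toℚᵘ (fromℚᵘ x) ∙ᵘ toℚᵘ (fromℚᵘ y)     ≈⟨ ℚᵘ.≃-sym (toℚᵘ-homo (fromℚᵘ x) (fromℚᵘ y)) ⟩
  toℚᵘ (fromℚᵘ x ∙ fromℚᵘ y)             ∎)
  where open ℚᵘ.≃-Reasoning

fromℚᵘ-homo-+ : ∀ x y → fromℚᵘ (x ℚᵘ.+ y) ≡ fromℚᵘ x + fromℚᵘ y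
fromℚᵘ-homo-+ = fromℚᵘ-homo₂ toℚᵘ-homo-+ ℚᵘ.+-cong

fromℚᵘ-homo-* : ∀ x y → fromℚᵘ (x ℚᵘ.* y) ≡ fromℚᵘ x * fromℚᵘ y
fromℚᵘ-homo-* = fromℚᵘ-homo₂ toℚᵘ-homo-* ℚᵘ.*-cong

fromℕ : ℕ → ℚ
fromℕ n = + n / 1

fromℕ-homo-+ : ∀ m n → fromℕ (m ℕ.+ n) ≡ fromℕ m + fromℕ n
fromℕ-homo-+ m n =
  trans (fromℚᵘ-cong {mkℚᵘ (+ (m ℕ.+ n)) 0} {mkℚᵘ (+ m) 0 ℚᵘ.+ mkℚᵘ (+ n) 0} (*≡* sum-num))
        (fromℚᵘ-homo-+ (mkℚᵘ (+ m) 0) (mkℚᵘ (+ n) 0))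
  where
  open ℤ-Solver
  sum-num : + (m ℕ.+ n) ℤ.* + 1 ≡ (+ m ℤ.* + 1 ℤ.+ + n ℤ.* + 1) ℤ.* + 1
  sum-num = trans (cong (ℤ._* + 1) (ℤ.pos-+ m n))
    (solve 2 (λ x y → (x :+ y) :* con (+ 1) := (x :* con (+ 1) :+ y :* con (+ 1)) :* con (+ 1)) refl (+ m) (+ n))

fromℕ-homo-* : ∀ m n → fromℕ (m ℕ.* n) ≡ fromℕ m * fromℕ n
fromℕ-homo-* m n =
  trans (fromℚᵘ-cong {mkℚᵘ (+ (m ℕ.* n)) 0} {mkℚᵘ (+ m) 0 ℚᵘ.* mkℚᵘ (+ n) 0}
          (*≡* (cong (ℤ._* + 1) (ℤ.pos-* m n))))
        (fromℚᵘ-homo-* (mkℚᵘ (+ m) 0) (mkℚᵘ (+ n) 0))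

n/d≡n*1/d : ∀ n d .{{_ : ℕ.NonZero d}} → + n / d ≡ fromℕ n * (+ 1 / d)
n/d≡n*1/d n (suc e) =
  trans (fromℚᵘ-cong {mkℚᵘ (+ n) e} {mkℚᵘ (+ n) 0 ℚᵘ.* mkℚᵘ (+ 1) e} (*≡* cross))
        (fromℚᵘ-homo-* (mkℚᵘ (+ n) 0) (mkℚᵘ (+ 1) e))
  where
  open ℤ-Solver
  cross : + n ℤ.* + suc (e ℕ.+ 0) ≡ (+ n ℤ.* + 1) ℤ.* + suc e
  cross = trans (cong (λ z → + n ℤ.* + suc z) (+-identityʳ e))
    (solve 2 (λ x y → x :* y := (x :* con (+ 1)) :* y) refl (+ n) (+ suc e))

1/d≡[1+k]*1/[[1+k]*d] : ∀ k d .{{_ : ℕ.NonZero d}} →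
  + 1 / d ≡ fromℕ (suc k) * (+ 1 / (suc k ℕ.* d)) {{m*n≢0 (suc k) d}}
1/d≡[1+k]*1/[[1+k]*d] k (suc e) =
  trans (fromℚᵘ-cong {mkℚᵘ (+ 1) e} {mkℚᵘ (+ suc k) 0 ℚᵘ.* mkℚᵘ (+ 1) e′} (*≡* cross))
        (fromℚᵘ-homo-* (mkℚᵘ (+ suc k) 0) (mkℚᵘ (+ 1) e′))
  where
  open ℤ-Solver
  e′ = e ℕ.+ k ℕ.* suc e
  cross : + 1 ℤ.* + suc (e′ ℕ.+ 0) ≡ (+ suc k ℤ.* + 1) ℤ.* + suc e
  cross = trans (cong (λ z → + 1 ℤ.* + suc z) (+-identityʳ e′))
    (solve 2 (λ x y → con (+ 1) :* (x :* y) := (x :* con (+ 1)) :* y) refl (+ suc k) (+ suc e))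

invFactorial : ℕ → ℚ
invFactorial m = (+ 1 / m !) {{m !≢0}}

invFactorial-suc : ∀ m → invFactorial m ≡ fromℕ (suc m) * invFactorial (suc m)
invFactorial-suc m = 1/d≡[1+k]*1/[[1+k]*d] m (m !) {{m !≢0}}

/!≡*invFactorial : ∀ n m → n /! m ≡ fromℕ n * invFactorial m
/!≡*invFactorial n m = n/d≡n*1/d n (m !) {{m !≢0}}

sumTo-cong : ∀ a {f g : ℕ → ℚ} → f ≗ g → sumTo a f ≡ sumTo a g
sumTo-cong zero    f≗g = f≗g 0
sumTo-cong (suc a) f≗g = cong₂ _+_ (sumTo-cong a f≗g) (f≗g (suc a))

sumTo-+ : ∀ a (f g : ℕ → ℚ) → sumTo a (λ q → f q + g q) ≡ sumTo a f + sumTo a g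
sumTo-+ zero    f g = refl
sumTo-+ (suc a) f g = trans (cong (_+ (f (suc a) + g (suc a))) (sumTo-+ a f g))
  (solve 4 (λ x y z w → (x :+ y) :+ (z :+ w) := (x :+ z) :+ (y :+ w)) refl
     (sumTo a f) (sumTo a g) (f (suc a)) (g (suc a)))
  where open ℚ-Solver

sumTo-unfoldˡ : ∀ a (f : ℕ → ℚ) → sumTo (suc a) f ≡ f 0 + sumTo a (f ∘ suc)
sumTo-unfoldˡ zero    f = refl
sumTo-unfoldˡ (suc a) f = trans (cong (_+ f (suc (suc a))) (sumTo-unfoldˡ a f))
  (ℚ.+-assoc (f 0) (sumTo a (f ∘ suc)) (f (suc (suc a))))

binomialSum : ℕ → (ℕ → ℚ) → ℚ
binomialSum a g = sumTo a (λ q → fromℕ (a C q) * g q)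

nC0≡1 : ∀ n → n C 0 ≡ 1
nC0≡1 n = trans (nCk≡nC[n∸k] {0} {n} ℕ.z≤n) (nCn≡1 n)

sumTo-C-unfoldˡ : ∀ n a (g : ℕ → ℚ) →
  sumTo (suc a) (λ q → fromℕ (n C q) * g q) ≡ g 0 + sumTo a (λ q → fromℕ (n C suc q) * g (suc q))
sumTo-C-unfoldˡ n a g = trans (sumTo-unfoldˡ a _)
  (cong (_+ sumTo a (λ q → fromℕ (n C suc q) * g (suc q)))
     (trans (cong (λ m → fromℕ m * g 0) (nC0≡1 n)) (ℚ.*-identityˡ (g 0))))

sumTo-C-extend : ∀ a (g : ℕ → ℚ) → sumTo (suc a) (λ q → fromℕ (a C q) * g q) ≡ binomialSum a g
sumTo-C-extend a g = begin
  binomialSum a g + fromℕ (a C suc a) * g (suc a) ≡⟨ cong (λ m → binomialSum a g + fromℕ m * g (suc a)) (k>n⇒nCk≡0 (n<1+n a)) ⟩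
  binomialSum a g + 0ℚ * g (suc a)                ≡⟨ cong (λ z → binomialSum a g + z) (ℚ.*-zeroˡ (g (suc a))) ⟩
  binomialSum a g + 0ℚ                            ≡⟨ ℚ.+-identityʳ (binomialSum a g) ⟩
  binomialSum a g                                 ∎
  where open ≡-Reasoning

binomialSum-pascal : ∀ a g → binomialSum (suc a) g ≡ binomialSum a g + binomialSum a (g ∘ suc)
binomialSum-pascal a g = begin
  binomialSum (suc a) g
    ≡⟨ sumTo-C-unfoldˡ (suc a) a g ⟩
  g 0 + sumTo a (λ q → fromℕ (suc a C suc q) * g (suc q))
    ≡⟨ cong (λ z → g 0 + z) (trans (sumTo-cong a pascal) (sumTo-+ a _ _)) ⟩
  g 0 + (binomialSum a (g ∘ suc) + tail)
    ≡⟨ solve 3 (λ x y z → x :+ (y :+ z) := (x :+ z) :+ y) refl (g 0) (binomialSum a (g ∘ suc)) tail ⟩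
  (g 0 + tail) + binomialSum a (g ∘ suc)
    ≡⟨ cong (_+ binomialSum a (g ∘ suc)) (trans (sym (sumTo-C-unfoldˡ a a g)) (sumTo-C-extend a g)) ⟩
  binomialSum a g + binomialSum a (g ∘ suc)
    ∎
  where
  open ≡-Reasoning
  open ℚ-Solver
  tail = sumTo a (λ q → fromℕ (a C suc q) * g (suc q))
  pascal : ∀ q → fromℕ (suc a C suc q) * g (suc q) ≡ fromℕ (a C q) * g (suc q) + fromℕ (a C suc q) * g (suc q)
  pascal q = begin
    fromℕ (suc a C suc q) * g (suc q)                 ≡⟨ cong (λ m → fromℕ m * g (suc q)) (sym (nCk+nC[k+1]≡[n+1]C[k+1] a q)) ⟩
    fromℕ (a C q ℕ.+ a C suc q) * g (suc q)           ≡⟨ cong (_* g (suc q)) (fromℕ-homo-+ (a C q) (a C suc q)) ⟩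
    (fromℕ (a C q) + fromℕ (a C suc q)) * g (suc q)   ≡⟨ ℚ.*-distribʳ-+ (g (suc q)) (fromℕ (a C q)) (fromℕ (a C suc q)) ⟩
    fromℕ (a C q) * g (suc q) + fromℕ (a C suc q) * g (suc q) ∎

-- Polynomials over ℚ as coefficient sequences, constant term first.
Coeffs : Set
Coeffs = ℕ → ℚ

X·_ : Coeffs → Coeffs
(X· f) zero    = 0ℚ
(X· f) (suc p) = f p

[X+_]·_ : ℚ → Coeffs → Coeffs
([X+ t ]· f) p = (X· f) p + t * f p

[X+]·-cong : ∀ t {f g} → f ≗ g → [X+ t ]· f ≗ [X+ t ]· g
[X+]·-cong t f≗g zero    = cong (λ z → 0ℚ + t * z) (f≗g 0)
[X+]·-cong t f≗g (suc p) = cong₂ (λ x y → x + t * y) (f≗g p) (f≗g (suc p))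

X·-[X+]· : ∀ t f → X· ([X+ t ]· f) ≗ [X+ t ]· (X· f)
X·-[X+]· t f zero    = sym (trans (ℚ.+-identityˡ (t * 0ℚ)) (ℚ.*-zeroʳ t))
X·-[X+]· t f (suc p) = refl

[X+]·-comm : ∀ s t f → [X+ s ]· ([X+ t ]· f) ≗ [X+ t ]· ([X+ s ]· f)
[X+]·-comm s t f p = begin
  (X· ([X+ t ]· f)) p + s * ([X+ t ]· f) p
    ≡⟨ cong (_+ s * ([X+ t ]· f) p) (X·-[X+]· t f p) ⟩
  ((X· X· f) p + t * (X· f) p) + s * ((X· f) p + t * f p)
    ≡⟨ solve 5 (λ a b c s t → (a :+ t :* b) :+ s :* (b :+ t :* c) := (a :+ s :* b) :+ t :* (b :+ s :* c))
         refl ((X· X· f) p) ((X· f) p) (f p) s t ⟩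
  ((X· X· f) p + s * (X· f) p) + t * ((X· f) p + s * f p)
    ≡⟨ cong (_+ t * ([X+ s ]· f) p) (sym (X·-[X+]· s f p)) ⟩
  (X· ([X+ s ]· f)) p + t * ([X+ s ]· f) p
    ∎
  where
  open ≡-Reasoning
  open ℚ-Solver

one : Coeffs
one zero    = 1ℚ
one (suc _) = 0ℚ

falling : ℕ → Coeffs
falling zero    = one
falling (suc n) = [X+ - fromℕ n ]· falling n

shiftedRising : ℕ → Coeffs → Coeffs
shiftedRising zero    f = f
shiftedRising (suc a) f = [X+ fromℕ (suc a) ]· shiftedRising a f

shiftedRising-[X+]· : ∀ a t f → shiftedRising a ([X+ t ]· f) ≗ [X+ t ]· shiftedRising a f
shiftedRising-[X+]· zero    t f p = refl
shiftedRising-[X+]· (suc a) t f p =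
  trans ([X+]·-cong (fromℕ (suc a)) (shiftedRising-[X+]· a t f) p)
        ([X+]·-comm (fromℕ (suc a)) t (shiftedRising a f) p)

vandermonde : ∀ a k p →
  binomialSum a (λ q → falling (k ℕ.+ q) p * invFactorial (k ℕ.+ q))
    ≡ shiftedRising a (falling k) p * invFactorial (k ℕ.+ a)
vandermonde zero    k p = trans (ℚ.*-identityˡ _)
  (cong (λ m → falling m p * invFactorial (k ℕ.+ 0)) (+-identityʳ k))
vandermonde (suc a) k p = begin
  binomialSum (suc a) g
    ≡⟨ binomialSum-pascal a g ⟩
  binomialSum a g + binomialSum a (g ∘ suc)
    ≡⟨ cong (λ z → binomialSum a g + z) (sumTo-cong a (λ q →
         cong (λ m → fromℕ (a C q) * (falling m p * invFactorial m)) (+-suc k q))) ⟩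
  binomialSum a g + binomialSum a (λ q → falling (suc k ℕ.+ q) p * invFactorial (suc k ℕ.+ q))
    ≡⟨ cong₂ _+_ (vandermonde a k p) (vandermonde a (suc k) p) ⟩
  y * invFactorial (k ℕ.+ a) + shiftedRising a (falling (suc k)) p * I
    ≡⟨ cong₂ (λ u v → y * v + u * I) (shiftedRising-[X+]· a (- K) (falling k) p) (invFactorial-suc (k ℕ.+ a)) ⟩
  y * (fromℕ (suc (k ℕ.+ a)) * I) + (x + (- K) * y) * I
    ≡⟨ cong (λ z → y * (z * I) + (x + (- K) * y) * I)
         (trans (cong fromℕ (sym (+-suc k a))) (fromℕ-homo-+ k (suc a))) ⟩
  y * ((K + A) * I) + (x + (- K) * y) * I
    ≡⟨ solve 5 (λ x y K A I → y :* ((K :+ A) :* I) :+ (x :+ (:- K) :* y) :* I := (x :+ A :* y) :* I)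
         refl x y K A I ⟩
  (x + A * y) * I
    ≡⟨ cong (λ m → (x + A * y) * invFactorial m) (sym (+-suc k a)) ⟩
  shiftedRising (suc a) (falling k) p * invFactorial (k ℕ.+ suc a)
    ∎
  where
  open ≡-Reasoning
  open ℚ-Solver
  g : ℕ → ℚ
  g q = falling (k ℕ.+ q) p * invFactorial (k ℕ.+ q)
  y = shiftedRising a (falling k) p
  x = (X· shiftedRising a (falling k)) p
  K = fromℕ k
  A = fromℕ (suc a)
  I = invFactorial (suc (k ℕ.+ a))

coeff-addP : ∀ f g p → coeff (addP f g) p ≡ coeff f p ℕ.+ coeff g p
coeff-addP []      g       p       = refl
coeff-addP (a ∷ f) []      p       = sym (+-identityʳ (coeff (a ∷ f) p))
coeff-addP (a ∷ f) (b ∷ g) zero    = refl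
coeff-addP (a ∷ f) (b ∷ g) (suc p) = coeff-addP f g p

coeff-scale : ∀ k f p → coeff (scale k f) p ≡ k ℕ.* coeff f p
coeff-scale k []      p       = sym (*-zeroʳ k)
coeff-scale k (a ∷ f) zero    = refl
coeff-scale k (a ∷ f) (suc p) = coeff-scale k f p

coeffℚ : Poly → Coeffs
coeffℚ f p = fromℕ (coeff f p)

coeffℚ-shiftX : ∀ f → coeffℚ (shiftX f) ≗ X· coeffℚ f
coeffℚ-shiftX f zero    = refl
coeffℚ-shiftX f (suc p) = refl

coeffℚ-mulLinear : ∀ k f → coeffℚ (mulLinear k f) ≗ [X+ fromℕ k ]· coeffℚ f
coeffℚ-mulLinear k f p = begin
  fromℕ (coeff (addP (shiftX f) (scale k f)) p)
    ≡⟨ cong fromℕ (coeff-addP (shiftX f) (scale k f) p) ⟩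
  fromℕ (coeff (shiftX f) p ℕ.+ coeff (scale k f) p)
    ≡⟨ fromℕ-homo-+ (coeff (shiftX f) p) (coeff (scale k f) p) ⟩
  coeffℚ (shiftX f) p + fromℕ (coeff (scale k f) p)
    ≡⟨ cong₂ _+_ (coeffℚ-shiftX f p) (trans (cong fromℕ (coeff-scale k f p)) (fromℕ-homo-* k (coeff f p))) ⟩
  (X· coeffℚ f) p + fromℕ k * coeffℚ f p
    ∎
  where open ≡-Reasoning

shiftedRising-falling1 : ∀ a → shiftedRising a (falling 1) ≗ coeffℚ (rising (suc a))
shiftedRising-falling1 zero    zero          = refl
shiftedRising-falling1 zero    (suc zero)    = refl
shiftedRising-falling1 zero    (suc (suc p)) = refl
shiftedRising-falling1 (suc a) p =
  trans ([X+]·-cong (fromℕ (suc a)) (shiftedRising-falling1 a) p)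
        (sym (coeffℚ-mulLinear (suc a) (rising (suc a)) p))

signed : ℕ → Coeffs → Coeffs
signed n f p = sgnDiff n p * f p

[X+-]·-signed : ∀ n t f → [X+ - t ]· signed n f ≗ signed (suc n) ([X+ t ]· f)
[X+-]·-signed n t f zero =
  solve 3 (λ t s x → con 0ℚ :+ (:- t) :* (s :* x) := (:- s) :* (con 0ℚ :+ t :* x)) refl t (sgn (n ℕ.+ 0)) (f 0)
  where open ℚ-Solver
[X+-]·-signed n t f (suc p) = begin
  s * f p + (- t) * (sgn (n ℕ.+ suc p) * f (suc p))
    ≡⟨ cong (λ m → s * f p + (- t) * (sgn m * f (suc p))) (+-suc n p) ⟩
  s * f p + (- t) * ((- s) * f (suc p))
    ≡⟨ solve 4 (λ t s x y → s :* x :+ (:- t) :* ((:- s) :* y) := (:- (:- s)) :* (x :+ t :* y)) refl t s (f p) (f (suc p)) ⟩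
  (- (- s)) * (f p + t * f (suc p))
    ≡⟨ cong (λ m → (- sgn m) * (f p + t * f (suc p))) (sym (+-suc n p)) ⟩
  sgn (suc n ℕ.+ suc p) * (f p + t * f (suc p))
    ∎
  where
  open ≡-Reasoning
  open ℚ-Solver
  s = sgn (n ℕ.+ p)

falling-signed : ∀ n → falling n ≗ signed n (coeffℚ (rising n))
falling-signed zero    zero    = refl
falling-signed zero    (suc p) = sym (ℚ.*-zeroʳ (sgn (suc p)))
falling-signed (suc n) p = begin
  ([X+ - fromℕ n ]· falling n) p
    ≡⟨ [X+]·-cong (- fromℕ n) (falling-signed n) p ⟩
  ([X+ - fromℕ n ]· signed n (coeffℚ (rising n))) p
    ≡⟨ [X+-]·-signed n (fromℕ n) (coeffℚ (rising n)) p ⟩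
  sgnDiff (suc n) p * ([X+ fromℕ n ]· coeffℚ (rising n)) p
    ≡⟨ cong (sgnDiff (suc n) p *_) (sym (coeffℚ-mulLinear n (rising n) p)) ⟩
  signed (suc n) (coeffℚ (rising (suc n))) p
    ∎
  where open ≡-Reasoning

sgnDiff*c/!≡falling*invFactorial : ∀ n p → sgnDiff n p * (c n p /! n) ≡ falling n p * invFactorial n
sgnDiff*c/!≡falling*invFactorial n p = begin
  sgnDiff n p * (c n p /! n)
    ≡⟨ cong (sgnDiff n p *_) (/!≡*invFactorial (c n p) n) ⟩
  sgnDiff n p * (fromℕ (c n p) * invFactorial n)
    ≡⟨ sym (ℚ.*-assoc (sgnDiff n p) (fromℕ (c n p)) (invFactorial n)) ⟩
  signed n (coeffℚ (rising n)) p * invFactorial n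
    ≡⟨ cong (_* invFactorial n) (sym (falling-signed n p)) ⟩
  falling n p * invFactorial n
    ∎
  where open ≡-Reasoning

-- The identity holds for p = 0 as well (both sides vanish).
lemma3p5 : (a p : ℕ) → p ≥ 1 →
    sumTo a (term a p) ≡ c (suc a) p /! suc a
lemma3p5 a p _ = begin
  sumTo a (term a p)
    ≡⟨ sumTo-cong a (λ q → cong (fromℕ (a C q) *_) (sgnDiff*c/!≡falling*invFactorial (suc q) p)) ⟩
  binomialSum a (λ q → falling (1 ℕ.+ q) p * invFactorial (1 ℕ.+ q))
    ≡⟨ vandermonde a 1 p ⟩
  shiftedRising a (falling 1) p * invFactorial (suc a)
    ≡⟨ cong (_* invFactorial (suc a)) (shiftedRising-falling1 a p) ⟩
  fromℕ (c (suc a) p) * invFactorial (suc a)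
    ≡⟨ sym (/!≡*invFactorial (c (suc a) p) (suc a)) ⟩
  c (suc a) p /! suc a
    ∎
  where open ≡-Reasoning
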